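{- Let $G$ be a simple graph on $\{1,\dots,\ell\}$, let $T$ be any separator of $G$ and let $C$ be a connected component of $G\setminus T$. Then $\theta_C^T=\sum_{i\in C}\prod_{t\in T}(x_i-x_t)\,D_i$ lies in $D(\mathcal{A}(G))$.
   Context: Let $\mathbb{K}$ be a field, $S=\mathbb{K}[x_1,\dots,x_\ell]$, $D_i=\partial/\partial x_i$. For a finite simple undirected graph $G=(V,E)$ with $V=\{1,\dots,\ell\}$, $\mathcal{A}(G)=\{\ker(x_i-x_j):\{i,j\}\in E\}$ and $D(\mathcal{A}(G))=\{\theta\in\mathrm{Der}_{\mathbb{K}}(S):\theta(x_i-x_j)\in(x_i-x_j)S\text{ for all }\{i,j\}\in E\}$. A set $T\subseteq V$ is a separator of $G$ if there exist vertices $a,b\notin T$ such that every path from $a$ to $b$ contains a vertex of $T$. $G\setminus T$ is the graph obtained by deleting $T$ and all edges incident to $T$; a connected component is identified with its vertex set. -}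

module Defs where

open import Level using (Level; _⊔_; suc)
open import Data.Nat using (ℕ)
open import Data.Fin using (Fin)
open import Data.Fin.Subset using (Subset; _∈_; _∉_; _⊆_)
open import Data.Fin.Subset.Properties using (_∈?_)
open import Data.List using (List; []; _∷_; foldr; allFin)
open import Data.List.Relation.Unary.Any using (Any)
open import Data.List.Relation.Unary.All using (All)
open import Data.List.Relation.Unary.Unique.Propositional using (Unique)
open import Data.Product using (Σ; ∃; _×_; _,_)
open import Relation.Nullary using (¬_; Dec; yes; no)
open import Relation.Binary.PropositionalEquality using (_≡_)
open import Algebra.Bundles using (CommutativeRing)

record Field (c ℓ : Level) : Set (suc (c ⊔ ℓ)) where
  field
    commutativeRing : CommutativeRing c ℓ
  open CommutativeRing commutativeRing public
  field
    1≉0     : ¬ (1# ≈ 0#)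
    inverse : ∀ x → ¬ (x ≈ 0#) → Σ Carrier (λ y → (x * y) ≈ 1#)

-- The polynomial ring S = K[x_1,…,x_n]: polynomial expressions modulo
-- the congruence generated by the commutative-ring axioms and by the
-- requirement that constants form a copy of K (i.e. the free commutative
-- K-algebra on n generators).

module Poly {c ℓ : Level} (K : Field c ℓ) (n : ℕ) where
  private module K = Field K

  infixl 6 _+_ _-_
  infixl 7 _*_
  infix 4 _≈_

  data Pol : Set c where
    con : K.Carrier → Pol
    var : Fin n → Pol
    _+_ : Pol → Pol → Pol
    _*_ : Pol → Pol → Pol
    -_  : Pol → Pol

  0P 1P : Pol
  0P = con K.0#
  1P = con K.1#

  _-_ : Pol → Pol → Pol
  p - q = p + (- q)

  data _≈_ : Pol → Pol → Set (c ⊔ ℓ) where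
    refl    : ∀ {p} → p ≈ p
    sym     : ∀ {p q} → p ≈ q → q ≈ p
    trans   : ∀ {p q r} → p ≈ q → q ≈ r → p ≈ r
    +-cong  : ∀ {p p' q q'} → p ≈ p' → q ≈ q' → p + q ≈ p' + q'
    *-cong  : ∀ {p p' q q'} → p ≈ p' → q ≈ q' → p * q ≈ p' * q'
    neg-cong : ∀ {p q} → p ≈ q → - p ≈ - q
    +-assoc : ∀ p q r → (p + q) + r ≈ p + (q + r)
    +-comm  : ∀ p q → p + q ≈ q + p
    +-idˡ   : ∀ p → 0P + p ≈ p
    -‿invˡ  : ∀ p → (- p) + p ≈ 0P
    *-assoc : ∀ p q r → (p * q) * r ≈ p * (q * r)
    *-comm  : ∀ p q → p * q ≈ q * p
    *-idˡ   : ∀ p → 1P * p ≈ p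
    distribʳ : ∀ p q r → (q + r) * p ≈ (q * p) + (r * p)
    con-cong : ∀ {a b} → a K.≈ b → con a ≈ con b
    con-+   : ∀ a b → con (a K.+ b) ≈ con a + con b
    con-*   : ∀ a b → con (a K.* b) ≈ con a * con b
    con-neg : ∀ a → con (K.- a) ≈ - con a

  _∣_ : Pol → Pol → Set (c ⊔ ℓ)
  q ∣ p = Σ Pol (λ r → p ≈ q * r)

  -- Derivations of S over K: θ = Σ_k f_k D_k, given by its coefficient
  -- vector (f_k)_k; its action on polynomials is the Leibniz extension.
  Der : Set c
  Der = Fin n → Pol

  apply : Der → Pol → Pol
  apply θ (con a) = 0P
  apply θ (var k) = θ k
  apply θ (p + q) = apply θ p + apply θ q
  apply θ (p * q) = (apply θ p * q) + (p * apply θ q)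
  apply θ (- p)   = - apply θ p

  prodOver : Subset n → Fin n → Pol
  prodOver T i = foldr step 1P (allFin n)
    where
    step : Fin n → Pol → Pol
    step t acc with t ∈? T
    ... | yes _ = (var i - var t) * acc
    ... | no  _ = acc

record Graph (n : ℕ) : Set₁ where
  field
    Edge    : Fin n → Fin n → Set
    edge?   : ∀ i j → Dec (Edge i j)
    sym     : ∀ {i j} → Edge i j → Edge j i
    irrefl  : ∀ {i} → ¬ Edge i i

module _ {n : ℕ} (G : Graph n) where
  open Graph G

  data Walk : Fin n → Fin n → Set where
    [] : ∀ {a} → Walk a a
    _∷_ : ∀ {a b c} → Edge a b → Walk b c → Walk a c

  vertices : ∀ {a b} → Walk a b → List (Fin n)
  vertices {a} []      = a ∷ []
  vertices {a} (e ∷ w) = a ∷ vertices w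

  IsPath : ∀ {a b} → Walk a b → Set
  IsPath w = Unique (vertices w)

  Separator : Subset n → Set
  Separator T = ∃ λ a → ∃ λ b → a ∉ T × b ∉ T ×
    (∀ (w : Walk a b) → IsPath w → Any (_∈ T) (vertices w))

  ConnectedIn∖ : Subset n → Fin n → Fin n → Set
  ConnectedIn∖ T a b = Σ (Walk a b) (λ w → All (_∉ T) (vertices w))

  ConnectedSet∖ : Subset n → Subset n → Set
  ConnectedSet∖ T D = (∀ i → i ∈ D → i ∉ T) ×
    (∀ i j → i ∈ D → j ∈ D → ConnectedIn∖ T i j)

  Component : Subset n → Subset n → Set
  Component T C = (∃ λ i → i ∈ C) × ConnectedSet∖ T C ×
    (∀ D → C ⊆ D → ConnectedSet∖ T D → D ⊆ C)

module _ {c ℓ : Level} (K : Field c ℓ) {n : ℕ} (G : Graph n) where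
  open Poly K n
  open Graph G

  InDA : Der → Set (c ⊔ ℓ)
  InDA θ = ∀ i j → Edge i j → (var i - var j) ∣ apply θ (var i - var j)

  θ[_,_] : Subset n → Subset n → Der
  θ[ C , T ] k with k ∈? C
  ... | yes _ = prodOver T k
  ... | no  _ = 0P

{-# OPTIONS --safe #-}
-- Modulo x_i - x_j the variables x_i and x_j coincide, hence so do the products
-- ∏_{t ∈ T} (x_i - x_t) and ∏_{t ∈ T} (x_j - x_t); this settles edges inside C.
-- An edge {i, j} leaving C must end in T, since otherwise C ∪ {j} would be a larger
-- connected set of G ∖ T; then x_i - x_j is itself a factor of the coefficient at i,
-- and the coefficient at j is 0.
module Submission where

open import Level using (Level; _⊔_)
open import Data.Nat using (ℕ)
open import Data.Fin using (Fin)
open import Data.Fin.Subset using (Subset; _∈_; _∉_; _∪_; ⁅_⁆)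
open import Data.Fin.Subset.Properties using (_∈?_; x∈⁅x⁆; x∈⁅y⁆⇒x≡y; p⊆p∪q; x∈p∪q⁺; x∈p∪q⁻)
open import Data.List using (List; []; _∷_; foldr; map; filter; allFin)
open import Data.List.Membership.Propositional using () renaming (_∈_ to _∈ₗ_)
open import Data.List.Membership.Propositional.Properties using (∈-map⁺; ∈-filter⁺; ∈-allFin)
open import Data.List.Relation.Unary.All using (All; []; _∷_)
open import Data.List.Relation.Unary.Any using (here; there)
open import Data.Product using (∃; _,_; proj₁)
open import Data.Sum as Sum using (_⊎_; inj₁; inj₂)
open import Relation.Nullary using (yes; no; contradiction)
import Relation.Binary.PropositionalEquality as ≡
open ≡ using (_≡_)
open import Relation.Binary.Structures using (IsEquivalence)
open import Relation.Binary.Bundles using (Setoid)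
import Relation.Binary.Reasoning.Setoid as SetoidReasoning
open import Algebra.Bundles using (CommutativeRing)
open import Algebra.Structures using (IsCommutativeRing)
import Algebra.Consequences.Setoid as Consequences
import Algebra.Properties.Ring as RingProperties
import Algebra.Properties.AbelianGroup as AbelianGroupProperties
import Algebra.Properties.CommutativeSemigroup.Divisibility as CommutativeDivisibility
import Algebra.Properties.Semiring.Divisibility as SemiringDivisibility
open import Defs

module CongruenceModulo {c ℓ : Level} (R : CommutativeRing c ℓ) where
  open CommutativeRing R
  open RingProperties ring using (-‿distribˡ-*; x[y-z]≈xy-xz; [y-z]x≈yx-zx)
  open AbelianGroupProperties +-abelianGroup using (ε⁻¹≈ε; ⁻¹-anti-homo‿-)
  open CommutativeDivisibility *-commutativeSemigroup public using (_∣_)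
  open CommutativeDivisibility *-commutativeSemigroup using (∣ʳ-trans; ∣ʳ-respʳ-≈; x∣xy; x∣ʳy⇒x∣ʳzy)
  open SemiringDivisibility semiring using (_∣0; ∣ʳ-refl)
  open import Algebra.Definitions.RawMagma *-rawMagma using (_,_)
  open SetoidReasoning setoid

  x∣y∧x∣z⇒x∣y+z : ∀ {d x y} → d ∣ x → d ∣ y → d ∣ x + y
  x∣y∧x∣z⇒x∣y+z {d} {x} {y} (p , pd≈x) (q , qd≈y) = p + q , (begin
    (p + q) * d    ≈⟨ distribʳ d p q ⟩
    p * d + q * d  ≈⟨ +-cong pd≈x qd≈y ⟩
    x + y          ∎)

  x∣y⇒x∣-y : ∀ {d x} → d ∣ x → d ∣ - x
  x∣y⇒x∣-y {d} {x} (q , qd≈x) = - q , (begin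
    - q * d    ≈⟨ -‿distribˡ-* q d ⟨
    - (q * d)  ≈⟨ -‿cong qd≈x ⟩
    - x        ∎)

  x∣y⇒x∣yz : ∀ {d x} y → d ∣ x → d ∣ x * y
  x∣y⇒x∣yz {x = x} y d∣x = ∣ʳ-respʳ-≈ (*-comm y x) (x∣ʳy⇒x∣ʳzy y d∣x)

  x-y+[y-z]≈x-z : ∀ x y z → (x - y) + (y - z) ≈ x - z
  x-y+[y-z]≈x-z x y z = begin
    (x - y) + (y - z)    ≈⟨ +-assoc x (- y) (y - z) ⟩
    x + (- y + (y - z))  ≈⟨ +-congˡ (+-assoc (- y) y (- z)) ⟨
    x + ((- y + y) - z)  ≈⟨ +-congˡ (+-congʳ (-‿inverseˡ y)) ⟩
    x + (0# - z)         ≈⟨ +-congˡ (+-identityˡ (- z)) ⟩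
    x - z                ∎

  xy-uv≈x[y-v]+[x-u]v : ∀ x y u v → x * y - u * v ≈ x * (y - v) + (x - u) * v
  xy-uv≈x[y-v]+[x-u]v x y u v = begin
    x * y - u * v                      ≈⟨ x-y+[y-z]≈x-z (x * y) (x * v) (u * v) ⟨
    (x * y - x * v) + (x * v - u * v)  ≈⟨ +-cong (x[y-z]≈xy-xz x y v) ([y-z]x≈yx-zx v x u) ⟨
    x * (y - v) + (x - u) * v          ∎

  infix 4 _≡_mod_
  _≡_mod_ : Carrier → Carrier → Carrier → Set (c ⊔ ℓ)
  x ≡ y mod d = d ∣ x - y

  ≡-mod-refl : ∀ {d} x → x ≡ x mod d
  ≡-mod-refl {d} x = ∣ʳ-respʳ-≈ (sym (-‿inverseʳ x)) (d ∣0)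

  ≡-mod-sym : ∀ {d x y} → x ≡ y mod d → y ≡ x mod d
  ≡-mod-sym {x = x} {y} d∣x-y = ∣ʳ-respʳ-≈ (⁻¹-anti-homo‿- x y) (x∣y⇒x∣-y d∣x-y)

  ≡-mod-* : ∀ {d x y u v} → x ≡ u mod d → y ≡ v mod d → x * y ≡ u * v mod d
  ≡-mod-* {x = x} {y} {u} {v} x≡u y≡v =
    ∣ʳ-respʳ-≈ (sym (xy-uv≈x[y-v]+[x-u]v x y u v)) (x∣y∧x∣z⇒x∣y+z (x∣ʳy⇒x∣ʳzy x y≡v) (x∣y⇒x∣yz v x≡u))

  ≡-mod-subʳ : ∀ {d x y} z → x ≡ y mod d → x - z ≡ y - z mod d
  ≡-mod-subʳ {x = x} {y} z x≡y = ∣ʳ-respʳ-≈ (begin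
    x - y              ≈⟨ x-y+[y-z]≈x-z x z y ⟨
    (x - z) + (z - y)  ≈⟨ +-congˡ (⁻¹-anti-homo‿- y z) ⟨
    (x - z) - (y - z)  ∎) x≡y

  ∣⇒≡0-mod : ∀ {d x} → d ∣ x → x ≡ 0# mod d
  ∣⇒≡0-mod {x = x} d∣x = ∣ʳ-respʳ-≈ (begin
    x          ≈⟨ +-identityʳ x ⟨
    x + 0#     ≈⟨ +-congˡ ε⁻¹≈ε ⟨
    x - 0#     ∎) d∣x

  ≡-mod-diff : ∀ x y → x ≡ y mod x - y
  ≡-mod-diff x y = ∣ʳ-refl

  ∣-swap-diff : ∀ {x y z} → y - x ∣ z → x - y ∣ z
  ∣-swap-diff {x} {y} = ∣ʳ-trans (≡-mod-sym (≡-mod-diff x y))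

  ∏-diff : Carrier → List Carrier → Carrier
  ∏-diff a = foldr (λ c p → (a - c) * p) 1#

  ∏-diff-cong-mod : ∀ {d a b} cs → a ≡ b mod d → ∏-diff a cs ≡ ∏-diff b cs mod d
  ∏-diff-cong-mod []       a≡b = ≡-mod-refl 1#
  ∏-diff-cong-mod (c ∷ cs) a≡b = ≡-mod-* (≡-mod-subʳ c a≡b) (∏-diff-cong-mod cs a≡b)

  ∈⇒diff∣∏-diff : ∀ a {c cs} → c ∈ₗ cs → a - c ∣ ∏-diff a cs
  ∈⇒diff∣∏-diff a {cs = c ∷ cs}  (here ≡.refl) = x∣xy (a - c) (∏-diff a cs)
  ∈⇒diff∣∏-diff a {cs = c′ ∷ cs} (there c∈cs) = x∣ʳy⇒x∣ʳzy (a - c′) (∈⇒diff∣∏-diff a c∈cs)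

module PolynomialRing {c ℓ : Level} (K : Field c ℓ) (n : ℕ) where
  open Poly K n renaming (_∣_ to _∣ᴾ_)

  ≈-isEquivalence : IsEquivalence _≈_
  ≈-isEquivalence = record { refl = refl ; sym = sym ; trans = trans }

  ≈-setoid : Setoid c (c ⊔ ℓ)
  ≈-setoid = record { isEquivalence = ≈-isEquivalence }

  isCommutativeRing : IsCommutativeRing _≈_ _+_ _*_ -_ 0P 1P
  isCommutativeRing = record
    { isRing = record
      { +-isAbelianGroup = record
        { isGroup = record
          { isMonoid = record
            { isSemigroup = record
              { isMagma = record { isEquivalence = ≈-isEquivalence ; ∙-cong = +-cong }
              ; assoc = +-assoc }
            ; identity = comm∧idˡ⇒id +-comm +-idˡ }
          ; inverse = comm∧invˡ⇒inv +-comm -‿invˡ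
          ; ⁻¹-cong = neg-cong }
        ; comm = +-comm }
      ; *-cong = *-cong
      ; *-assoc = *-assoc
      ; *-identity = comm∧idˡ⇒id *-comm *-idˡ
      ; distrib = comm∧distrʳ⇒distr +-cong *-comm distribʳ }
    ; *-comm = *-comm }
    where open Consequences ≈-setoid

  commutativeRing : CommutativeRing c (c ⊔ ℓ)
  commutativeRing = record { isCommutativeRing = isCommutativeRing }

  open CongruenceModulo commutativeRing using (_∣_; ∏-diff)
  open import Algebra.Definitions.RawMagma (CommutativeRing.*-rawMagma commutativeRing) using (_,_)

  ∣⇒∣ᴾ : ∀ {d p} → d ∣ p → d ∣ᴾ p
  ∣⇒∣ᴾ {d} (q , qd≈p) = q , trans (sym qd≈p) (*-comm q d)

  vars : Subset n → List Pol
  vars T = map var (filter (_∈? T) (allFin n))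

  var∈vars : ∀ {T t} → t ∈ T → var t ∈ₗ vars T
  var∈vars {T} {t} t∈T = ∈-map⁺ var (∈-filter⁺ (_∈? T) (∈-allFin t) t∈T)

  -- prodOver folds a step function local to its where-block, which cannot be named;
  -- unification recovers it.
  prodOver-unfold : ∀ T i → ∃ λ (step : Fin n → Pol → Pol) → prodOver T i ≡ foldr step 1P (allFin n)
  prodOver-unfold T i = _ , ≡.refl

  prodOver≡∏-diff : ∀ T i → prodOver T i ≡ ∏-diff (var i) (vars T)
  prodOver≡∏-diff T i = go (allFin n)
    where
    go : ∀ ts → foldr (proj₁ (prodOver-unfold T i)) 1P ts ≡ ∏-diff (var i) (map var (filter (_∈? T) ts))
    go []       = ≡.refl
    go (t ∷ ts) with t ∈? T
    ... | yes _ = ≡.cong ((var i - var t) *_) (go ts)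
    ... | no _  = go ts

module ComponentBoundary {n : ℕ} (G : Graph n) where
  open Graph G

  _++ʷ_ : ∀ {a b c} → Walk G a b → Walk G b c → Walk G a c
  []      ++ʷ w′ = w′
  (e ∷ w) ++ʷ w′ = e ∷ (w ++ʷ w′)

  All-++ʷ : ∀ {p} {P : Fin n → Set p} {a b c} {w : Walk G a b} {w′ : Walk G b c}
    → All P (vertices G w) → All P (vertices G w′) → All P (vertices G (w ++ʷ w′))
  All-++ʷ {w = []}    _         Pw′ = Pw′
  All-++ʷ {w = _ ∷ _} (Pa ∷ Pw) Pw′ = Pa ∷ All-++ʷ Pw Pw′

  connectedSet∖-∪-neighbour : ∀ {T C i j} → ConnectedSet∖ G T C → i ∈ C → Edge i j → j ∉ T
    → ConnectedSet∖ G T (C ∪ ⁅ j ⁆)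
  connectedSet∖-∪-neighbour {T} {C} {i} {j} (C∌T , walkC) i∈C i~j j∉T = avoidsT , walk
    where
    ∈-∪-⁅⁆⁻ : ∀ {k} → k ∈ C ∪ ⁅ j ⁆ → k ∈ C ⊎ k ≡ j
    ∈-∪-⁅⁆⁻ k∈ = Sum.map₂ (x∈⁅y⁆⇒x≡y j) (x∈p∪q⁻ C ⁅ j ⁆ k∈)

    avoidsT : ∀ k → k ∈ C ∪ ⁅ j ⁆ → k ∉ T
    avoidsT k k∈ with ∈-∪-⁅⁆⁻ k∈
    ... | inj₁ k∈C    = C∌T k k∈C
    ... | inj₂ ≡.refl = j∉T

    walk : ∀ a b → a ∈ C ∪ ⁅ j ⁆ → b ∈ C ∪ ⁅ j ⁆ → ConnectedIn∖ G T a b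
    walk a b a∈ b∈ with ∈-∪-⁅⁆⁻ a∈ | ∈-∪-⁅⁆⁻ b∈
    ... | inj₁ a∈C    | inj₁ b∈C    = walkC a b a∈C b∈C
    ... | inj₁ a∈C    | inj₂ ≡.refl =
      let (w , w∉T) = walkC a i a∈C i∈C in w ++ʷ (i~j ∷ []) , All-++ʷ w∉T (C∌T i i∈C ∷ j∉T ∷ [])
    ... | inj₂ ≡.refl | inj₁ b∈C    =
      let (w , w∉T) = walkC i b i∈C b∈C in sym i~j ∷ w , j∉T ∷ w∉T
    ... | inj₂ ≡.refl | inj₂ ≡.refl = [] , j∉T ∷ []

  leaving-edge⇒∈T : ∀ {T C i j} → Component G T C → Edge i j → i ∈ C → j ∉ C → j ∈ T
  leaving-edge⇒∈T {T} {C} {i} {j} (_ , connectedC , maximal) i~j i∈C j∉C with j ∈? T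
  ... | yes j∈T = j∈T
  ... | no  j∉T = contradiction (maximal (C ∪ ⁅ j ⁆) (p⊆p∪q ⁅ j ⁆) C∪j-connected (x∈p∪q⁺ (inj₂ (x∈⁅x⁆ j)))) j∉C
    where
    C∪j-connected : ConnectedSet∖ G T (C ∪ ⁅ j ⁆)
    C∪j-connected = connectedSet∖-∪-neighbour connectedC i∈C i~j j∉T

module ThetaCongruence {c ℓ : Level} (K : Field c ℓ) {n : ℕ} (G : Graph n) where
  open Graph G using (Edge; sym)
  open Poly K n using (var; prodOver; 0P; _-_)
  open PolynomialRing K n
  open CongruenceModulo commutativeRing
  open ComponentBoundary G

  prodOver-≡-mod : ∀ T i j → prodOver T i ≡ prodOver T j mod var i - var j
  prodOver-≡-mod T i j rewrite prodOver≡∏-diff T i | prodOver≡∏-diff T j =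
    ∏-diff-cong-mod (vars T) (≡-mod-diff (var i) (var j))

  diff∣prodOver : ∀ {T} i {j} → j ∈ T → var i - var j ∣ prodOver T i
  diff∣prodOver {T} i j∈T rewrite prodOver≡∏-diff T i = ∈⇒diff∣∏-diff (var i) (var∈vars j∈T)

  θ-≡-mod : ∀ {T C i j} → Component G T C → Edge i j → θ[_,_] K G C T i ≡ θ[_,_] K G C T j mod var i - var j
  θ-≡-mod {T} {C} {i} {j} component i~j with i ∈? C | j ∈? C
  ... | yes _   | yes _   = prodOver-≡-mod T i j
  ... | yes i∈C | no  j∉C = ∣⇒≡0-mod (diff∣prodOver i (leaving-edge⇒∈T component i~j i∈C j∉C))
  ... | no  i∉C | yes j∈C =
    ≡-mod-sym (∣⇒≡0-mod (∣-swap-diff (diff∣prodOver j (leaving-edge⇒∈T component (sym i~j) j∈C i∉C))))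
  ... | no  _   | no  _   = ≡-mod-refl 0P

lemma3p3 : ∀ {c ℓ' : Level} (K : Field c ℓ') (ℓ : ℕ) (G : Graph ℓ) (T : Subset ℓ) (C : Subset ℓ)
    → Separator G T → Component G T C
    → InDA K G (θ[_,_] K G C T)
lemma3p3 K ℓ G T C _ component i j i~j =
  PolynomialRing.∣⇒∣ᴾ K ℓ (ThetaCongruence.θ-≡-mod K G component i~j)
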